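{- For every $N\in\mathbb{N}$, \[ \mathcal{N}_2(N)=2\sum_{L=2}^\infty c_L(N), \] where $\mathcal{N}_2(N)$ is the number of $2$-part sum systems $(A_1,A_2)$ with $A_1,A_2\subset\mathbb{N}_0$, $|A_1|,|A_2|\ge 2$, $|A_1||A_2|=N$ and $A_1+A_2=\{0,1,\dots,N-1\}$.
   Context: $c_L=(1-e)^{*L}$ (Dirichlet convolution power, with $e(n)=\delta_{n,1}$ and $1$ the constant function) is the non-trivial divisor function: $c_L(n)$ is the number of ordered factorisations $n=n_1n_2\cdots n_L$ with all $n_i\ge 2$. $A_1+A_2$ denotes the Minkowski sum, and the pairs $(A_1,A_2)$ are ordered. -}

module Defs where

open import Data.Nat using (ℕ; zero; suc; _+_; _*_; _∸_; _≤_; _<_; _≟_)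
open import Data.Nat.Divisibility using (_∣?_)
open import Data.Nat.DivMod using (_/_)
open import Data.Bool using (if_then_else_)
open import Data.Fin using (Fin; toℕ)
open import Data.Fin.Subset using (Subset; inside; outside; _∈_; ∣_∣)
open import Data.Fin.Subset.Properties using (_∈?_)
open import Data.Fin.Properties using (all?; any?)
open import Data.List using (List; []; _∷_; _++_; map; length; filter; cartesianProduct)
open import Data.Vec using (Vec; []; _∷_)
open import Data.Product using (Σ; ∃; _×_; _,_; proj₁; proj₂)
open import Relation.Nullary using (Dec; does)
open import Relation.Nullary.Decidable using (_×-dec_; _→-dec_)
open import Relation.Binary.PropositionalEquality using (_≡_)

-- Arithmetic functions and Dirichlet convolution (on positive integers;
-- the value at 0 is irrelevant).

sumTo : (ℕ → ℕ) → ℕ → ℕ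
sumTo f zero    = f zero
sumTo f (suc M) = sumTo f M + f (suc M)

sumBelow : ℕ → (ℕ → ℕ) → ℕ
sumBelow zero    f = 0
sumBelow (suc n) f = sumBelow n f + f n

_⋆_ : (ℕ → ℕ) → (ℕ → ℕ) → ℕ → ℕ
(f ⋆ g) n = sumBelow n (λ k → if does (suc k ∣? n) then f (suc k) * g (n / suc k) else 0)

e : ℕ → ℕ
e n = if does (n ≟ 1) then 1 else 0

one : ℕ → ℕ
one _ = 1

-- 1 - e  (non-negative, so truncated subtraction is exact)
oneMinusE : ℕ → ℕ
oneMinusE n = one n ∸ e n

c : ℕ → ℕ → ℕ
c zero    = e
c (suc L) = oneMinusE ⋆ c L

-- A pair (A₁ , A₂) of finite subsets of ℕ₀ is
-- represented by subsets of Fin N = {0,…,N-1}  (any A₁,A₂ ⊆ ℕ₀ with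
-- A₁ + A₂ = {0,…,N-1} automatically lies in {0,…,N-1}, as both are nonempty).

IsSumSystem : (N : ℕ) → Subset N → Subset N → Set
IsSumSystem N A₁ A₂ =
    2 ≤ ∣ A₁ ∣ × 2 ≤ ∣ A₂ ∣ × ∣ A₁ ∣ * ∣ A₂ ∣ ≡ N
  × (∀ (a b : Fin N) → a ∈ A₁ → b ∈ A₂ → toℕ a + toℕ b < N)
  × (∀ (k : Fin N) → Σ (Fin N) λ a → Σ (Fin N) λ b →
        a ∈ A₁ × b ∈ A₂ × toℕ a + toℕ b ≡ toℕ k)

isSumSystem? : (N : ℕ) (A₁ A₂ : Subset N) → Dec (IsSumSystem N A₁ A₂)
isSumSystem? N A₁ A₂ =
  (2 Data.Nat.≤? ∣ A₁ ∣) ×-dec (2 Data.Nat.≤? ∣ A₂ ∣) ×-dec (∣ A₁ ∣ * ∣ A₂ ∣ ≟ N)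
  ×-dec all? (λ a → all? (λ b → (a ∈? A₁) →-dec ((b ∈? A₂) →-dec (toℕ a + toℕ b Data.Nat.<? N))))
  ×-dec all? (λ k → any? (λ a → any? (λ b →
          (a ∈? A₁) ×-dec (b ∈? A₂) ×-dec (toℕ a + toℕ b ≟ toℕ k))))

allSubsets : (n : ℕ) → List (Subset n)
allSubsets zero    = [] ∷ []
allSubsets (suc n) = map (inside ∷_) (allSubsets n) ++ map (outside ∷_) (allSubsets n)

𝒩₂ : ℕ → ℕ
𝒩₂ N = length (filter (λ p → isSumSystem? N (proj₁ p) (proj₂ p))
                      (cartesianProduct (allSubsets N) (allSubsets N)))

-- By de Bruijn's theorem, a pair with A₁ + A₂ = {0, …, N-1} and |A₁| |A₂| = N (so that every
-- x < N is a + b in exactly one way) comes from an ordered factorisation N = m₁ m₂ ⋯ m_L, mᵢ ≥ 2.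
-- If 1 ∈ A₁ and m₁ is the least number missing from A₁, then A₂ ⊆ m₁ℕ, A₁ is a union of blocks
-- [q m₁, q m₁ + m₁), m₁ ∣ N, and (A₂ / m₁, (A₁ ∩ m₁ℕ) / m₁) is again such a pair for N / m₁, now with
-- 1 in the first part. Conversely every factorisation gives such a pair: A₁ and A₂ collect the
-- numbers whose mixed-radix digits (radices m₁, m₂, …) vanish at the even, respectively odd, places.
-- Both parts have at least two elements exactly when L ≥ 2, the factor 2 records which part
-- contains 1, factorisations into L factors are counted by c_L(N), and L < N.

module Submission where

open import Defs
open import Data.Bool using (Bool; true; false; _∧_; if_then_else_)
open import Data.Empty using (⊥; ⊥-elim)
open import Data.Fin using (Fin; zero; suc; toℕ; fromℕ<)
open import Data.Fin.Properties using (toℕ<n; toℕ-fromℕ<)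
open import Data.Fin.Subset using (Subset; inside; outside; ∣_∣) renaming (_∈_ to _∈ₛ_)
open import Data.Vec using ([]; _∷_; lookup)
open import Data.Vec.Properties using ([]=⇒lookup; lookup⇒[]=) renaming (∷-injectiveʳ to ∷-injectiveʳᵥ)
open import Data.List using (List; []; _∷_; _++_; map; length; filter; upTo; cartesianProduct)
open import Data.List.Membership.Propositional using (_∈_)
open import Data.List.Membership.Propositional.Properties
open import Data.List.Properties using (length-++; length-map; length-upTo; ∷-injective; ∷-injectiveʳ)
open import Data.List.Relation.Binary.Subset.Propositional using (_⊆_)
open import Data.List.Relation.Unary.All using (All; []; _∷_)
import Data.List.Relation.Unary.All as All
open import Data.List.Relation.Unary.Any using (here; there)
open import Data.List.Relation.Unary.Unique.Propositional using (Unique; []; _∷_)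
import Data.List.Relation.Unary.Unique.Propositional.Properties as Unique
open import Data.Nat using (ℕ; zero; suc; pred; _+_; _*_; _≤_; _<_; z≤n; s≤s; _≟_; NonZero; >-nonZero; >-nonZero⁻¹)
open import Data.Nat.Divisibility using (_∣_; _∣?_; divides; ∣⇒≤; _∣0; ∣-refl; ∣m∣n⇒∣m+n; ∣m+n∣m⇒∣n; n∣m*n; m∣m*n)
open import Data.Nat.DivMod
open import Data.Nat.Induction using (<-rec)
open import Data.Nat.ListAction using (product)
open import Data.Nat.Properties
open import Data.Product using (Σ; ∃; ∃₂; _×_; _,_; proj₁; proj₂; uncurry)
open import Data.Product.Properties using (≡-dec)
open import Data.Sum using (_⊎_; inj₁; inj₂)
open import Function using (_∘_)
open import Relation.Binary.Definitions using (DecidableEquality; tri<; tri≈; tri>)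
open import Relation.Binary.PropositionalEquality
open import Relation.Nullary using (¬_; Dec; yes; no; does; contradiction)
open import Relation.Nullary.Decidable using (dec-true; dec-false)

module _ {A : Set} where

  length-++-∷ : ∀ (us : List A) x vs → length (us ++ x ∷ vs) ≡ suc (length (us ++ vs))
  length-++-∷ []       x vs = refl
  length-++-∷ (u ∷ us) x vs = cong suc (length-++-∷ us x vs)

  ∈-++-∷-≢ : ∀ {x z : A} us vs → z ∈ us ++ x ∷ vs → z ≢ x → z ∈ us ++ vs
  ∈-++-∷-≢ []       vs (here z≡x) z≢x = contradiction z≡x z≢x
  ∈-++-∷-≢ []       vs (there z∈) z≢x = z∈
  ∈-++-∷-≢ (u ∷ us) vs (here z≡u) z≢x = here z≡u
  ∈-++-∷-≢ (u ∷ us) vs (there z∈) z≢x = there (∈-++-∷-≢ us vs z∈ z≢x)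

  Unique⇒length≤ : ∀ {xs ys : List A} → Unique xs → xs ⊆ ys → length xs ≤ length ys
  Unique⇒length≤ {[]}     _          _  = z≤n
  Unique⇒length≤ {x ∷ xs} (x∉ ∷ !xs) xs⊆ys with us , vs , refl ← ∈-∃++ (xs⊆ys (here refl)) =
    subst (suc (length xs) ≤_) (sym (length-++-∷ us x vs))
      (s≤s (Unique⇒length≤ !xs λ z∈ → ∈-++-∷-≢ us vs (xs⊆ys (there z∈)) (λ z≡x → All.lookup x∉ z∈ (sym z≡x))))

  Unique⇒length≡ : ∀ {xs ys : List A} → Unique xs → Unique ys → xs ⊆ ys → ys ⊆ xs → length xs ≡ length ys
  Unique⇒length≡ !xs !ys xs⊆ys ys⊆xs = ≤-antisym (Unique⇒length≤ !xs xs⊆ys) (Unique⇒length≤ !ys ys⊆xs)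

  length-cartesianProduct : ∀ {B : Set} (xs : List A) (ys : List B) →
    length (cartesianProduct xs ys) ≡ length xs * length ys
  length-cartesianProduct []       ys = refl
  length-cartesianProduct (x ∷ xs) ys = begin
    length (map (x ,_) ys ++ cartesianProduct xs ys)     ≡⟨ length-++ (map (x ,_) ys) ⟩
    length (map (x ,_) ys) + length (cartesianProduct xs ys) ≡⟨ cong₂ _+_ (length-map (x ,_) ys) (length-cartesianProduct xs ys) ⟩
    length ys + length xs * length ys                    ∎
    where open ≡-Reasoning

module _ {A B : Set} (f : A → B) where

  map⁺-injectiveOn : ∀ {xs} → Unique xs → (∀ {x y} → x ∈ xs → y ∈ xs → f x ≡ f y → x ≡ y) → Unique (map f xs)
  map⁺-injectiveOn {[]}     []         inj = []
  map⁺-injectiveOn {x ∷ xs} (x∉ ∷ !xs) inj =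
    All.tabulate fx∉ ∷ map⁺-injectiveOn !xs (λ p q → inj (there p) (there q))
    where
    fx∉ : ∀ {z} → z ∈ map f xs → f x ≢ z
    fx∉ z∈ fx≡z with w , w∈ , refl ← ∈-map⁻ f z∈ = All.lookup x∉ w∈ (inj (here refl) (there w∈) fx≡z)

  length≤⇒injectiveOn : DecidableEquality A → ∀ {xs ys} → Unique ys → ys ⊆ map f xs → length xs ≤ length ys →
    ∀ {x x'} → x ∈ xs → x' ∈ xs → f x ≡ f x' → x ≡ x'
  length≤⇒injectiveOn _≟_ {ys = ys} !ys ys⊆ |xs|≤|ys| {x} {x'} x∈ x'∈ fx≡fx' with x ≟ x'
  ... | yes x≡x' = x≡x'
  ... | no  x≢x' with us , vs , refl ← ∈-∃++ x∈ = ⊥-elim (n≮n _ too-long)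
    where
    open ≤-Reasoning
    ys⊆rest : ys ⊆ map f (us ++ vs)
    ys⊆rest y∈ with w , w∈ , refl ← ∈-map⁻ f (ys⊆ y∈) with w ≟ x
    ... | yes refl = subst (_∈ map f (us ++ vs)) (sym fx≡fx') (∈-map⁺ f (∈-++-∷-≢ us vs x'∈ (x≢x' ∘ sym)))
    ... | no  w≢x  = ∈-map⁺ f (∈-++-∷-≢ us vs w∈ w≢x)
    too-long : suc (length (us ++ vs)) ≤ length (us ++ vs)
    too-long = begin
      suc (length (us ++ vs))   ≡⟨ length-++-∷ us x vs ⟨
      length (us ++ x ∷ vs)     ≤⟨ |xs|≤|ys| ⟩
      length ys                 ≤⟨ Unique⇒length≤ !ys ys⊆rest ⟩
      length (map f (us ++ vs)) ≡⟨ length-map f (us ++ vs) ⟩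
      length (us ++ vs)         ∎

module _ {A P : Set} where

  ∈-if⁻ : ∀ (P? : Dec P) {x : A} {xs} → x ∈ (if does P? then xs else []) → P × x ∈ xs
  ∈-if⁻ (yes p) x∈ = p , x∈

  ∈-if⁺ : ∀ (P? : Dec P) {x : A} {xs} → P → x ∈ xs → x ∈ (if does P? then xs else [])
  ∈-if⁺ (yes _) p x∈ = x∈
  ∈-if⁺ (no ¬p) p _  = contradiction p ¬p

  Unique-if : ∀ (P? : Dec P) {xs : List A} → Unique xs → Unique (if does P? then xs else [])
  Unique-if (yes _) !xs = !xs
  Unique-if (no _)  _   = []

concatBelow : ∀ {A : Set} → ℕ → (ℕ → List A) → List A
concatBelow zero    f = []
concatBelow (suc n) f = concatBelow n f ++ f n

module _ {A : Set} where

  length-concatBelow : ∀ n (f : ℕ → List A) → length (concatBelow n f) ≡ sumBelow n (length ∘ f)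
  length-concatBelow zero    f = refl
  length-concatBelow (suc n) f =
    trans (length-++ (concatBelow n f)) (cong (_+ length (f n)) (length-concatBelow n f))

  ∈-concatBelow⁺ : ∀ {x : A} n f {k} → k < n → x ∈ f k → x ∈ concatBelow n f
  ∈-concatBelow⁺ (suc n) f {k} k<1+n x∈ with k ≟ n
  ... | yes refl = ∈-++⁺ʳ (concatBelow n f) x∈
  ... | no  k≢n  = ∈-++⁺ˡ (∈-concatBelow⁺ n f (≤∧≢⇒< (≤-pred k<1+n) k≢n) x∈)

  ∈-concatBelow⁻ : ∀ {x : A} n f → x ∈ concatBelow n f → ∃ λ k → k < n × x ∈ f k
  ∈-concatBelow⁻ (suc n) f x∈ with ∈-++⁻ (concatBelow n f) x∈
  ... | inj₁ x∈ˡ = let k , k<n , x∈fk = ∈-concatBelow⁻ n f x∈ˡ in k , m<n⇒m<1+n k<n , x∈fk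
  ... | inj₂ x∈fn = n , ≤-refl , x∈fn

  Unique-concatBelow : ∀ n (f : ℕ → List A) → (∀ k → Unique (f k)) →
    (∀ {x i j} → x ∈ f i → x ∈ f j → i ≡ j) → Unique (concatBelow n f)
  Unique-concatBelow zero    f !f disjoint = []
  Unique-concatBelow (suc n) f !f disjoint =
    Unique.++⁺ (Unique-concatBelow n f !f disjoint) (!f n) λ (x∈ˡ , x∈fn) →
      let k , k<n , x∈fk = ∈-concatBelow⁻ n f x∈ˡ in <-irrefl (disjoint x∈fk x∈fn) k<n

sumTo≡sumBelow : ∀ f M → sumTo f M ≡ sumBelow (suc M) f
sumTo≡sumBelow f zero    = refl
sumTo≡sumBelow f (suc M) = cong (_+ f (suc M)) (sumTo≡sumBelow f M)

sumBelow-cong : ∀ n {f g : ℕ → ℕ} → (∀ k → f k ≡ g k) → sumBelow n f ≡ sumBelow n g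
sumBelow-cong zero    f≗g = refl
sumBelow-cong (suc n) f≗g = cong₂ _+_ (sumBelow-cong n f≗g) (f≗g n)

-- Ordered factorisations

Factorisation : ℕ → ℕ → List ℕ → Set
Factorisation L n ms = length ms ≡ L × All (2 ≤_) ms × product ms ≡ n

product≥1 : ∀ {ms} → All (2 ≤_) ms → 1 ≤ product ms
product≥1 []           = s≤s z≤n
product≥1 (m≥2 ∷ ms≥2) = *-mono-≤ (≤-trans (s≤s z≤n) m≥2) (product≥1 ms≥2)

length<product : ∀ {ms} → All (2 ≤_) ms → length ms < product ms
length<product {[]}     []           = s≤s z≤n
length<product {m ∷ ms} (m≥2 ∷ ms≥2) = begin-strict
  suc (length ms)         <⟨ s≤s (length<product ms≥2) ⟩
  suc (product ms)        ≤⟨ +-monoˡ-≤ (product ms) (product≥1 ms≥2) ⟩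
  product ms + product ms ≡⟨ cong (product ms +_) (+-identityʳ (product ms)) ⟨
  2 * product ms          ≤⟨ *-monoˡ-≤ (product ms) m≥2 ⟩
  m * product ms          ∎
  where open ≤-Reasoning

-- Factor 1 is excluded, matching (1 - e)(1) = 0.
prependFactor : ℕ → List (List ℕ) → List (List ℕ)
prependFactor 1 mss = []
prependFactor d mss = map (d ∷_) mss

factorisations : ℕ → ℕ → List (List ℕ)
factorisations zero    n = if does (n ≟ 1) then [] ∷ [] else []
factorisations (suc L) n = concatBelow n λ k →
  if does (suc k ∣? n) then prependFactor (suc k) (factorisations L (n / suc k)) else []

length-prependFactor : ∀ d mss → length (prependFactor d mss) ≡ oneMinusE d * length mss
length-prependFactor zero          mss = trans (length-map _ mss) (sym (+-identityʳ _))
length-prependFactor (suc zero)    mss = refl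
length-prependFactor (suc (suc k)) mss = trans (length-map _ mss) (sym (+-identityʳ _))

length-factorisations : ∀ L n → length (factorisations L n) ≡ c L n
length-factorisations zero n with does (n ≟ 1)
... | true  = refl
... | false = refl
length-factorisations (suc L) n =
  trans (length-concatBelow n _) (sumBelow-cong n λ k → length-summand k (does (suc k ∣? n)))
  where
  length-summand : ∀ k b → length (if b then prependFactor (suc k) (factorisations L (n / suc k)) else [])
                                 ≡ (if b then oneMinusE (suc k) * c L (n / suc k) else 0)
  length-summand k true  = trans (length-prependFactor (suc k) _) (cong (oneMinusE (suc k) *_) (length-factorisations L _))
  length-summand k false = refl

factorisations⁻ : ∀ L n {ms} → ms ∈ factorisations L n → Factorisation L n ms
factorisations⁻ zero n ms∈ with refl , here refl ← ∈-if⁻ (n ≟ 1) ms∈ = refl , [] , refl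
factorisations⁻ (suc L) n ms∈ with k , _ , ms∈ₖ ← ∈-concatBelow⁻ n _ ms∈ with k | ∈-if⁻ (suc k ∣? n) ms∈ₖ
... | suc k | d∣n , ms∈ₖ with ms , ms∈ , refl ← ∈-map⁻ _ ms∈ₖ
    with |ms|≡L , ms≥2 , ∏ms≡ ← factorisations⁻ L _ ms∈ =
  cong suc |ms|≡L , s≤s (s≤s z≤n) ∷ ms≥2 , trans (cong ((2 + k) *_) ∏ms≡) (m*[n/m]≡n d∣n)

factorisations⁺ : ∀ L n {ms} → Factorisation L n ms → ms ∈ factorisations L n
factorisations⁺ zero    n {[]} (refl , [] , refl) = ∈-if⁺ (1 ≟ 1) refl (here refl)
factorisations⁺ (suc L) n {1 ∷ ms} (_ , s≤s () ∷ _ , _)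
factorisations⁺ (suc L) n {suc (suc k) ∷ ms} (|ms|≡L , _ ∷ ms≥2 , refl) =
  ∈-concatBelow⁺ n _ {suc k} d≤n (∈-if⁺ (2 + k ∣? n) (m∣m*n (product ms)) (∈-map⁺ _ ms∈))
  where
  d≤n : 2 + k ≤ (2 + k) * product ms
  d≤n = m≤m*n (2 + k) (product ms) {{>-nonZero (product≥1 ms≥2)}}
  [d*∏ms]/d≡∏ms : (2 + k) * product ms / (2 + k) ≡ product ms
  [d*∏ms]/d≡∏ms = trans (cong (_/ (2 + k)) (*-comm (2 + k) (product ms))) (m*n/n≡m (product ms) (2 + k))
  ms∈ : ms ∈ factorisations L ((2 + k) * product ms / (2 + k))
  ms∈ = subst (λ n' → ms ∈ factorisations L n') (sym [d*∏ms]/d≡∏ms)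
          (factorisations⁺ L (product ms) (suc-injective |ms|≡L , ms≥2 , refl))

∈-prependFactor⁻ : ∀ d {mss ms} → ms ∈ prependFactor d mss → ∃ λ ms' → ms ≡ d ∷ ms'
∈-prependFactor⁻ zero          ms∈ with ms' , _ , refl ← ∈-map⁻ _ ms∈ = ms' , refl
∈-prependFactor⁻ (suc (suc k)) ms∈ with ms' , _ , refl ← ∈-map⁻ _ ms∈ = ms' , refl

Unique-prependFactor : ∀ d {mss} → Unique mss → Unique (prependFactor d mss)
Unique-prependFactor zero          !mss = Unique.map⁺ ∷-injectiveʳ !mss
Unique-prependFactor (suc zero)    !mss = []
Unique-prependFactor (suc (suc k)) !mss = Unique.map⁺ ∷-injectiveʳ !mss

Unique-factorisations : ∀ L n → Unique (factorisations L n)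
Unique-factorisations zero    n = Unique-if (n ≟ 1) ([] ∷ [])
Unique-factorisations (suc L) n = Unique-concatBelow n summand
  (λ k → Unique-if (suc k ∣? n) (Unique-prependFactor (suc k) (Unique-factorisations L _)))
  λ {_} {i} {j} ms∈ᵢ ms∈ⱼ → suc-injective (first-factor≡ i ms∈ᵢ ms∈ⱼ)
  where
  summand : ℕ → List (List ℕ)
  summand k = if does (suc k ∣? n) then prependFactor (suc k) (factorisations L (n / suc k)) else []
  first-factor≡ : ∀ i {j ms} → ms ∈ summand i → ms ∈ summand j → suc i ≡ suc j
  first-factor≡ i {j} ms∈ᵢ ms∈ⱼ
    with _ , refl ← ∈-prependFactor⁻ (suc i) (proj₂ (∈-if⁻ (suc i ∣? n) ms∈ᵢ))
       | _ , eq   ← ∈-prependFactor⁻ (suc j) (proj₂ (∈-if⁻ (suc j ∣? n) ms∈ⱼ)) = proj₁ (∷-injective eq)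

factorisations≥2 : ℕ → ℕ → List (List ℕ)
factorisations≥2 M n = concatBelow (suc M) λ k → factorisations (2 + k) n

length-factorisations≥2 : ∀ M n → length (factorisations≥2 M n) ≡ sumTo (λ k → c (2 + k) n) M
length-factorisations≥2 M n = begin
  length (factorisations≥2 M n)                          ≡⟨ length-concatBelow (suc M) _ ⟩
  sumBelow (suc M) (λ k → length (factorisations (2 + k) n)) ≡⟨ sumBelow-cong (suc M) (λ k → length-factorisations (2 + k) n) ⟩
  sumBelow (suc M) (λ k → c (2 + k) n)                   ≡⟨ sumTo≡sumBelow _ M ⟨
  sumTo (λ k → c (2 + k) n) M                            ∎
  where open ≡-Reasoning

factorisations≥2⁻ : ∀ M n {ms} → ms ∈ factorisations≥2 M n → ∃ λ k → Factorisation (2 + k) n ms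
factorisations≥2⁻ M n ms∈ with k , _ , ms∈ₖ ← ∈-concatBelow⁻ (suc M) _ ms∈ = k , factorisations⁻ (2 + k) n ms∈ₖ

factorisations≥2⁺ : ∀ M n {ms k} → k ≤ M → Factorisation (2 + k) n ms → ms ∈ factorisations≥2 M n
factorisations≥2⁺ M n k≤M fact = ∈-concatBelow⁺ (suc M) _ (s≤s k≤M) (factorisations⁺ _ n fact)

Unique-factorisations≥2 : ∀ M n → Unique (factorisations≥2 M n)
Unique-factorisations≥2 M n = Unique-concatBelow (suc M) _ (λ k → Unique-factorisations (2 + k) n)
  λ ms∈ᵢ ms∈ⱼ → +-cancelˡ-≡ 2 _ _ (trans (sym (proj₁ (factorisations⁻ _ n ms∈ᵢ))) (proj₁ (factorisations⁻ _ n ms∈ⱼ)))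

true≢false : true ≢ false
true≢false ()

Bool-ext : ∀ {p q : Bool} → (p ≡ true → q ≡ true) → (q ≡ true → p ≡ true) → p ≡ q
Bool-ext {false} {false} _   _   = refl
Bool-ext {false} {true}  _   q⇒p = q⇒p refl
Bool-ext {true}          p⇒q _   = sym (p⇒q refl)

∧-true⁻ : ∀ {p q} → p ∧ q ≡ true → p ≡ true × q ≡ true
∧-true⁻ {true} {true} _ = refl , refl

isZero : ℕ → Bool
isZero zero    = true
isZero (suc _) = false

isZero⇒≡0 : ∀ {x} → isZero x ≡ true → x ≡ 0
isZero⇒≡0 {zero} _ = refl

least-false : ∀ (P : ℕ → Bool) n → (∀ x → x < n → P x ≡ true) ⊎
              ∃ λ m → m < n × P m ≡ false × (∀ x → x < m → P x ≡ true)
least-false P zero    = inj₁ λ _ ()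
least-false P (suc n) with least-false P n
... | inj₂ (m , m<n , gap , below) = inj₂ (m , m<n⇒m<1+n m<n , gap , below)
... | inj₁ below with P n in Pn
...   | false = inj₂ (n , ≤-refl , Pn , below)
...   | true  = inj₁ λ x x<1+n → case (m≤n⇒m<n∨m≡n (≤-pred x<1+n))
  where
  case : ∀ {x} → x < n ⊎ x ≡ n → P x ≡ true
  case (inj₁ x<n) = below _ x<n
  case (inj₂ refl) = Pn

least-false-unique : ∀ {P : ℕ → Bool} {m m'} → (∀ x → x < m → P x ≡ true) → P m ≡ false →
                     (∀ x → x < m' → P x ≡ true) → P m' ≡ false → m ≡ m'
least-false-unique {P} {m} {m'} below gap below' gap' with <-cmp m m'
... | tri< m<m' _ _ = ⊥-elim (true≢false (trans (sym (below' m m<m')) gap))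
... | tri≈ _ m≡m' _ = m≡m'
... | tri> _ _ m>m' = ⊥-elim (true≢false (trans (sym (below m' m>m')) gap'))

m/o<n⇒m<n*o : ∀ {m n o} .{{_ : NonZero o}} → m / o < n → m < n * o
m/o<n⇒m<n*o {m} {n} {o} m/o<n = begin-strict
  m                 ≡⟨ m≡m%n+[m/n]*n m o ⟩
  m % o + m / o * o <⟨ +-monoˡ-< (m / o * o) (m%n<n m o) ⟩
  suc (m / o) * o   ≤⟨ *-monoˡ-≤ o m/o<n ⟩
  n * o             ∎
  where open ≤-Reasoning

-- Direct sum decompositions of [0, N)

record DirectSum (N : ℕ) (A B : ℕ → Bool) : Set where
  field
    sum<   : ∀ {a b} → A a ≡ true → B b ≡ true → a + b < N
    cover  : ∀ {x} → x < N → ∃₂ λ a b → A a ≡ true × B b ≡ true × a + b ≡ x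
    unique : ∀ {a b a' b'} → A a ≡ true → B b ≡ true → A a' ≡ true → B b' ≡ true →
             a + b ≡ a' + b' → a ≡ a'

  uniqueʳ : ∀ {a b a' b'} → A a ≡ true → B b ≡ true → A a' ≡ true → B b' ≡ true →
            a + b ≡ a' + b' → b ≡ b'
  uniqueʳ a∈ b∈ a'∈ b'∈ eq = +-cancelˡ-≡ _ _ _ (trans eq (cong (_+ _) (sym (unique a∈ b∈ a'∈ b'∈ eq))))

  0∈A×0∈B : 1 ≤ N → A 0 ≡ true × B 0 ≡ true
  0∈A×0∈B 1≤N with cover 1≤N
  ... | zero , zero , 0∈A , 0∈B , _ = 0∈A , 0∈B

  0∈A : 1 ≤ N → A 0 ≡ true
  0∈A 1≤N = proj₁ (0∈A×0∈B 1≤N)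

  0∈B : 1 ≤ N → B 0 ≡ true
  0∈B 1≤N = proj₂ (0∈A×0∈B 1≤N)

  A-bounded : 1 ≤ N → ∀ {a} → A a ≡ true → a < N
  A-bounded 1≤N {a} a∈ = subst (_< N) (+-identityʳ a) (sum< a∈ (0∈B 1≤N))

  B-bounded : 1 ≤ N → ∀ {b} → B b ≡ true → b < N
  B-bounded 1≤N = sum< (0∈A 1≤N)

DirectSum-swap : ∀ {N A B} → DirectSum N A B → DirectSum N B A
DirectSum-swap {N} ds = record
  { sum<   = λ {b} {a} b∈ a∈ → subst (_< N) (+-comm a b) (sum< a∈ b∈)
  ; cover  = λ x<N → let a , b , a∈ , b∈ , eq = cover x<N in b , a , b∈ , a∈ , trans (+-comm b a) eq
  ; unique = λ {b} {a} {b'} {a'} b∈ a∈ b'∈ a'∈ eq →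
               uniqueʳ a∈ b∈ a'∈ b'∈ (trans (+-comm a b) (trans eq (+-comm b' a')))
  }
  where open DirectSum ds

DirectSum-resp : ∀ {N A B A' B'} → (∀ x → A x ≡ A' x) → (∀ x → B x ≡ B' x) →
                 DirectSum N A B → DirectSum N A' B'
DirectSum-resp A≗A' B≗B' ds = record
  { sum<   = λ a∈ b∈ → sum< (to A≗A' a∈) (to B≗B' b∈)
  ; cover  = λ x<N → let a , b , a∈ , b∈ , eq = cover x<N in
               a , b , from A≗A' a∈ , from B≗B' b∈ , eq
  ; unique = λ a∈ b∈ a'∈ b'∈ → unique (to A≗A' a∈) (to B≗B' b∈) (to A≗A' a'∈) (to B≗B' b'∈)
  }
  where
  open DirectSum ds
  to : ∀ {P Q : ℕ → Bool} → (∀ x → P x ≡ Q x) → ∀ {x} → Q x ≡ true → P x ≡ true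
  to P≗Q {x} = trans (P≗Q x)
  from : ∀ {P Q : ℕ → Bool} → (∀ x → P x ≡ Q x) → ∀ {x} → P x ≡ true → Q x ≡ true
  from P≗Q {x} = trans (sym (P≗Q x))

DirectSum-unit : DirectSum 1 isZero isZero
DirectSum-unit = record
  { sum<   = λ {a} {b} a∈ b∈ → subst₂ (λ a b → a + b < 1) (sym (isZero⇒≡0 a∈)) (sym (isZero⇒≡0 b∈)) (s≤s z≤n)
  ; cover  = λ { (s≤s z≤n) → 0 , 0 , refl , refl , refl }
  ; unique = λ a∈ _ a'∈ _ _ → trans (isZero⇒≡0 a∈) (sym (isZero⇒≡0 a'∈))
  }

module _ (d : ℕ) .{{_ : NonZero d}} where

  -- [0, d) + d · Y
  blocks : (ℕ → Bool) → ℕ → Bool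
  blocks Y x = Y (x / d)

  dilate : (ℕ → Bool) → ℕ → Bool
  dilate X x = does (d ∣? x) ∧ X (x / d)

  dilate-* : ∀ X x → dilate X (x * d) ≡ X x
  dilate-* X x = trans (cong (_∧ X (x * d / d)) (dec-true (d ∣? x * d) (divides x refl))) (cong X (m*n/n≡m x d))

  dilate⁻ : ∀ X {b} → dilate X b ≡ true → ∃ λ β → b ≡ β * d × X β ≡ true
  dilate⁻ X {b} b∈ with ∧-true⁻ {does (d ∣? b)} b∈
  ... | d∣b , Xb/d with d ∣? b
  ... | yes (divides β refl) = β , refl , trans (cong X (sym (m*n/n≡m β d))) Xb/d

  private
    [r+q*d]%d≡r : ∀ r q → r < d → (r + q * d) % d ≡ r
    [r+q*d]%d≡r r q r<d = trans ([m+kn]%n≡m%n r q d) (m<n⇒m%n≡m r<d)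

    [r+q*d]/d≡q : ∀ r q → r < d → (r + q * d) / d ≡ q
    [r+q*d]/d≡q r q r<d = trans (+-distrib-/-∣ʳ r (divides q refl)) (cong₂ _+_ (m<n⇒m/n≡0 r<d) (m*n/n≡m q d))

    quot-rem-unique : ∀ {r r' q q'} → r < d → r' < d → r + q * d ≡ r' + q' * d → r ≡ r' × q ≡ q'
    quot-rem-unique {r} {r'} {q} {q'} r<d r'<d eq =
        trans (sym ([r+q*d]%d≡r r q r<d)) (trans (cong (_% d) eq) ([r+q*d]%d≡r r' q' r'<d))
      , trans (sym ([r+q*d]/d≡q r q r<d)) (trans (cong (_/ d) eq) ([r+q*d]/d≡q r' q' r'<d))

    regroup : ∀ a β → a + β * d ≡ a % d + (a / d + β) * d
    regroup a β = begin
      a + β * d                     ≡⟨ cong (_+ β * d) (m≡m%n+[m/n]*n a d) ⟩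
      a % d + a / d * d + β * d     ≡⟨ +-assoc (a % d) _ _ ⟩
      a % d + (a / d * d + β * d)   ≡⟨ cong (a % d +_) (*-distribʳ-+ d (a / d) β) ⟨
      a % d + (a / d + β) * d       ∎
      where open ≡-Reasoning

  DirectSum-stretch : ∀ {N X Y} → DirectSum N X Y → DirectSum (d * N) (blocks Y) (dilate X)
  DirectSum-stretch {N} {X} {Y} ds = record { sum< = sum<′ ; cover = cover′ ; unique = unique′ }
    where
    open DirectSum ds
    sum<′ : ∀ {a b} → blocks Y a ≡ true → dilate X b ≡ true → a + b < d * N
    sum<′ {a} a∈ b∈ with β , refl , Xβ ← dilate⁻ X b∈ = begin-strict
      a + β * d                 ≡⟨ regroup a β ⟩
      a % d + (a / d + β) * d   <⟨ +-monoˡ-< _ (m%n<n a d) ⟩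
      suc (a / d + β) * d       ≤⟨ *-monoˡ-≤ d (subst (_< N) (+-comm β (a / d)) (sum< Xβ a∈)) ⟩
      N * d                     ≡⟨ *-comm N d ⟩
      d * N                     ∎
      where open ≤-Reasoning
    cover′ : ∀ {x} → x < d * N → ∃₂ λ a b → blocks Y a ≡ true × dilate X b ≡ true × a + b ≡ x
    cover′ {x} x<dN with b′ , a′ , Xb′ , Ya′ , eq ← cover (m<n*o⇒m/o<n (subst (x <_) (*-comm d N) x<dN)) =
        x % d + a′ * d , b′ * d
      , trans (cong Y ([r+q*d]/d≡q (x % d) a′ (m%n<n x d))) Ya′
      , trans (dilate-* X b′) Xb′
      , (begin
          x % d + a′ * d + b′ * d   ≡⟨ +-assoc (x % d) _ _ ⟩
          x % d + (a′ * d + b′ * d) ≡⟨ cong (x % d +_) (*-distribʳ-+ d a′ b′) ⟨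
          x % d + (a′ + b′) * d     ≡⟨ cong (λ q → x % d + q * d) (trans (+-comm a′ b′) eq) ⟩
          x % d + x / d * d         ≡⟨ m≡m%n+[m/n]*n x d ⟨
          x                         ∎)
      where open ≡-Reasoning
    unique′ : ∀ {a b a' b'} → blocks Y a ≡ true → dilate X b ≡ true → blocks Y a' ≡ true → dilate X b' ≡ true →
              a + b ≡ a' + b' → a ≡ a'
    unique′ {a} {_} {a'} a∈ b∈ a'∈ b'∈ eq
      with β , refl , Xβ ← dilate⁻ X b∈ | β' , refl , Xβ' ← dilate⁻ X b'∈
      with r≡ , q≡ ← quot-rem-unique (m%n<n a d) (m%n<n a' d) (trans (sym (regroup a β)) (trans eq (regroup a' β')))
      with refl ← unique Xβ a∈ Xβ' a'∈ (trans (+-comm β (a / d)) (trans q≡ (+-comm (a' / d) β'))) = begin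
        a                   ≡⟨ m≡m%n+[m/n]*n a d ⟩
        a % d + a / d * d   ≡⟨ cong₂ (λ r q → r + q * d) r≡ (+-cancelʳ-≡ β _ _ q≡) ⟩
        a' % d + a' / d * d ≡⟨ m≡m%n+[m/n]*n a' d ⟨
        a'                  ∎
      where open ≡-Reasoning

  blocks-< : ∀ Y {x} → Y 0 ≡ true → x < d → blocks Y x ≡ true
  blocks-< Y Y0 x<d = trans (cong Y (m<n⇒m/n≡0 x<d)) Y0

  blocks-* : ∀ Y x → blocks Y (x * d) ≡ Y x
  blocks-* Y x = cong Y (m*n/n≡m x d)

-- de Bruijn's construction

-- The clauses for a factor 0 are arbitrary: all factors are ≥ 2.
encodeA encodeB : List ℕ → ℕ → Bool
encodeA []           = isZero
encodeA (zero  ∷ ms) = isZero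
encodeA (suc k ∷ ms) = blocks (suc k) (encodeB ms)
encodeB []           = isZero
encodeB (zero  ∷ ms) = isZero
encodeB (suc k ∷ ms) = dilate (suc k) (encodeA ms)

DirectSum-encode : ∀ {ms} → All (2 ≤_) ms → DirectSum (product ms) (encodeA ms) (encodeB ms)
DirectSum-encode {[]}              []                   = DirectSum-unit
DirectSum-encode {suc (suc k) ∷ _} (s≤s (s≤s _) ∷ ms≥2) = DirectSum-stretch (2 + k) (DirectSum-encode ms≥2)

encode-0 : ∀ {ms} → All (2 ≤_) ms → encodeA ms 0 ≡ true × encodeB ms 0 ≡ true
encode-0 ms≥2 = DirectSum.0∈A×0∈B (DirectSum-encode ms≥2) (product≥1 ms≥2)

encodeB-1 : ∀ {ms} → All (2 ≤_) ms → encodeB ms 1 ≡ false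
encodeB-1 {[]}               _                   = refl
encodeB-1 {suc (suc k) ∷ ms} (s≤s (s≤s _) ∷ _) =
  cong (_∧ encodeA ms (1 / (2 + k))) (dec-false (2 + k ∣? 1) λ d∣1 → <⇒≱ (s≤s (s≤s z≤n)) (∣⇒≤ d∣1))

encodeA-below : ∀ {m ms} → All (2 ≤_) (m ∷ ms) → ∀ x → x < m → encodeA (m ∷ ms) x ≡ true
encodeA-below {suc (suc k)} {ms} (s≤s (s≤s _) ∷ ms≥2) x x<m = blocks-< (2 + k) (encodeB ms) (proj₂ (encode-0 ms≥2)) x<m

encodeA-gap : ∀ {m ms} → All (2 ≤_) (m ∷ ms) → encodeA (m ∷ ms) m ≡ false
encodeA-gap {suc (suc k)} {ms} (s≤s (s≤s _) ∷ ms≥2) = trans (cong (encodeB ms) (n/n≡1 (2 + k))) (encodeB-1 ms≥2)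

encode-injective : ∀ {ms ms'} → All (2 ≤_) ms → All (2 ≤_) ms' →
                   (∀ x → encodeA ms x ≡ encodeA ms' x) → (∀ x → encodeB ms x ≡ encodeB ms' x) → ms ≡ ms'
encode-injective [] [] _ _ = refl
encode-injective [] ms'≥2@(m'≥2 ∷ _) A≗A' _ =
  ⊥-elim (true≢false (trans (sym (encodeA-below ms'≥2 1 m'≥2)) (sym (A≗A' 1))))
encode-injective ms≥2@(m≥2 ∷ _) [] A≗A' _ =
  ⊥-elim (true≢false (trans (sym (encodeA-below ms≥2 1 m≥2)) (A≗A' 1)))
encode-injective {m ∷ ms} {m' ∷ ms'} ms≥2 ms'≥2 A≗A' B≗B'
  with refl ← least-false-unique (encodeA-below ms≥2) (encodeA-gap ms≥2)
                (λ x x<m' → trans (A≗A' x) (encodeA-below ms'≥2 x x<m')) (trans (A≗A' m') (encodeA-gap ms'≥2))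
  = cong (m ∷_) (encode-injective-tail ms≥2 ms'≥2 A≗A' B≗B')
  where
  encode-injective-tail : ∀ {m ms ms'} → All (2 ≤_) (m ∷ ms) → All (2 ≤_) (m ∷ ms') →
    (∀ x → encodeA (m ∷ ms) x ≡ encodeA (m ∷ ms') x) → (∀ x → encodeB (m ∷ ms) x ≡ encodeB (m ∷ ms') x) → ms ≡ ms'
  encode-injective-tail {suc (suc k)} {ms} {ms'} (s≤s (s≤s _) ∷ ms≥2) (_ ∷ ms'≥2) A≗A' B≗B' =
    encode-injective ms≥2 ms'≥2
      (λ x → trans (sym (dilate-* (2 + k) (encodeA ms) x)) (trans (B≗B' (x * (2 + k))) (dilate-* (2 + k) (encodeA ms') x)))
      (λ x → trans (sym (blocks-* (2 + k) (encodeB ms) x)) (trans (A≗A' (x * (2 + k))) (blocks-* (2 + k) (encodeB ms') x)))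

-- Every direct sum decomposition comes from a factorisation

-- The situation where m is the least element missing from A (so m ∈ B): then B ⊆ m ℕ
-- and A is a union of blocks [q m, q m + m).
module FirstGap {N A B} (ds : DirectSum N A B) (m : ℕ) .{{_ : NonZero m}}
                (below : ∀ x → x < m → A x ≡ true) (m∈B : B m ≡ true) where

  open DirectSum ds

  1≤N : 1 ≤ N
  1≤N = ≤-trans (s≤s z≤n) (sum< (below 0 (>-nonZero⁻¹ m)) m∈B)

  m-1<m : pred m < m
  m-1<m = subst (pred m <_) (suc-pred m) (n<1+n (pred m))

  Invariant : ℕ → Set
  Invariant x = (B x ≡ true → m ∣ x) × (¬ m ∣ x → A x ≡ A (pred x))

  module Step {x} (1+x<N : suc x < N) (ih : ∀ {y} → y < suc x → Invariant y) where

    -- In a + (b + 1) = x both a + 1 and b + 1 lie below x + 1, where the invariant is known.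
    shift : ∀ {a b} → B (suc b) ≡ true → a + suc b ≡ x → ¬ m ∣ suc x → A (suc a) ≡ A a
    shift {a} {b} 1+b∈B eq m∤1+x = proj₂ (ih 1+a≤x) m∤1+a
      where
      1+a≤x : suc a < suc x
      1+a≤x = s≤s (subst (suc a ≤_) (trans (sym (+-suc a b)) eq) (s≤s (m≤m+n a b)))
      m∣1+b : m ∣ suc b
      m∣1+b = proj₁ (ih (s≤s (subst (suc b ≤_) eq (m≤n+m (suc b) a)))) 1+b∈B
      m∤1+a : ¬ m ∣ suc a
      m∤1+a m∣1+a = m∤1+x (subst (m ∣_) (cong suc eq) (∣m∣n⇒∣m+n m∣1+a m∣1+b))

    B-step : B (suc x) ≡ true → m ∣ suc x
    B-step 1+x∈B with m ∣? suc x | cover (<-trans (n<1+n x) 1+x<N)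
    ... | yes m∣1+x | _ = m∣1+x
    ... | no  _     | a , zero , a∈A , _ , refl = subst (m ∣_) 1+x≡m ∣-refl
      where
      open ≡-Reasoning
      sums≡ : a + m ≡ pred m + suc (a + 0)
      sums≡ = begin
        a + m                  ≡⟨ +-comm a m ⟩
        m + a                  ≡⟨ cong₂ _+_ (suc-pred m) (+-identityʳ a) ⟨
        suc (pred m) + (a + 0) ≡⟨ +-suc (pred m) (a + 0) ⟨
        pred m + suc (a + 0)   ∎
      1+x≡m : m ≡ suc (a + 0)
      1+x≡m = begin
        m                ≡⟨ suc-pred m ⟨
        suc (pred m)     ≡⟨ cong suc (unique a∈A m∈B (below (pred m) m-1<m) 1+x∈B sums≡) ⟨
        suc a            ≡⟨ cong suc (+-identityʳ a) ⟨
        suc (a + 0)      ∎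
    ... | no  m∤1+x | a , suc b , a∈A , 1+b∈B , eq =
      contradiction (unique (trans (shift 1+b∈B eq m∤1+x) a∈A) 1+b∈B (0∈A 1≤N) 1+x∈B (cong suc eq)) λ ()

    A-step : ¬ m ∣ suc x → A (suc x) ≡ A x
    A-step m∤1+x = Bool-ext forward backward
      where
      forward : A (suc x) ≡ true → A x ≡ true
      forward 1+x∈A with cover (<-trans (n<1+n x) 1+x<N)
      ... | a , zero  , a∈A , _     , refl = subst (λ z → A z ≡ true) (sym (+-identityʳ a)) a∈A
      ... | a , suc b , a∈A , 1+b∈B , eq   = contradiction
            (uniqueʳ (trans (shift 1+b∈B eq m∤1+x) a∈A) 1+b∈B 1+x∈A (0∈B 1≤N) (trans (cong suc eq) (sym (+-identityʳ _)))) λ ()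
      backward : A x ≡ true → A (suc x) ≡ true
      backward x∈A with cover 1+x<N
      ... | a     , zero  , a∈A , _     , eq = subst (λ z → A z ≡ true) (trans (sym (+-identityʳ a)) eq) a∈A
      ... | zero  , suc b , _   , 1+b∈B , eq = contradiction (B-step (subst (λ z → B z ≡ true) eq 1+b∈B)) m∤1+x
      ... | suc a , suc b , 1+a∈A , 1+b∈B , eq = contradiction
            (uniqueʳ (trans (sym (shift 1+b∈B (suc-injective eq) m∤1+x)) 1+a∈A) 1+b∈B x∈A (0∈B 1≤N)
                     (trans (suc-injective eq) (sym (+-identityʳ x)))) λ ()

  invariant : ∀ x → x < N → Invariant x
  invariant = <-rec (λ x → x < N → Invariant x) step
    where
    step : ∀ x → (∀ {y} → y < x → y < N → Invariant y) → x < N → Invariant x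
    step zero    _  _     = (λ _ → m ∣0) , (λ m∤0 → contradiction (m ∣0) m∤0)
    step (suc x) ih 1+x<N = B-step , A-step
      where open Step 1+x<N (λ y<1+x → ih y<1+x (<-trans y<1+x 1+x<N))

  B⊆mℕ : ∀ {b} → B b ≡ true → m ∣ b
  B⊆mℕ b∈B = proj₁ (invariant _ (B-bounded 1≤N b∈B)) b∈B

  A-block : ∀ r q → r < m → r + q * m < N → A (r + q * m) ≡ A (q * m)
  A-block zero    q _     _ = refl
  A-block (suc r) q 1+r<m 1+r+qm<N =
    trans (proj₂ (invariant _ 1+r+qm<N) m∤) (A-block r q (<-trans (n<1+n r) 1+r<m) (<-trans (n<1+n _) 1+r+qm<N))
    where
    m∤ : ¬ m ∣ suc r + q * m
    m∤ m∣ = <⇒≱ 1+r<m (∣⇒≤ (∣m+n∣m⇒∣n (subst (m ∣_) (+-comm (suc r) (q * m)) m∣) (n∣m*n q)))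

  A-blocks : ∀ {x} → x < N → A x ≡ A (x / m * m)
  A-blocks {x} x<N = trans (cong A (m≡m%n+[m/n]*n x m))
    (A-block (x % m) (x / m) (m%n<n x m) (subst (_< N) (m≡m%n+[m/n]*n x m) x<N))

  m∣N : m ∣ N
  m∣N = subst (m ∣_) 1+[N-1]≡N m∣1+[N-1]
    where
    1+[N-1]≡N : suc (pred N) ≡ N
    1+[N-1]≡N = suc-pred N {{>-nonZero 1≤N}}
    N-1<N : pred N < N
    N-1<N = subst (pred N <_) 1+[N-1]≡N (n<1+n (pred N))
    m∣1+[N-1] : m ∣ suc (pred N)
    m∣1+[N-1] with cover N-1<N
    ... | a , zero , a∈A , _ , eq = contradiction (sum< a∈A m∈B) (≤⇒≯ (begin
          N                 ≡⟨ 1+[N-1]≡N ⟨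
          suc (pred N)      ≡⟨ cong suc (trans (sym (+-identityʳ a)) eq) ⟨
          suc a             ≡⟨ +-comm 1 a ⟩
          a + 1             ≤⟨ +-monoʳ-≤ a (>-nonZero⁻¹ m) ⟩
          a + m             ∎))
      where open ≤-Reasoning
    ... | a , suc b , a∈A , 1+b∈B , eq with m ∣? suc a
    ...   | yes m∣1+a = subst (m ∣_) (cong suc eq) (∣m∣n⇒∣m+n m∣1+a (B⊆mℕ 1+b∈B))
    ...   | no  m∤1+a = contradiction (sum< 1+a∈A 1+b∈B) (≤⇒≯ (≤-reflexive (trans (sym 1+[N-1]≡N) (cong suc (sym eq)))))
      where
      1+a<N : suc a < N
      1+a<N = ≤-trans (s≤s (subst (suc a ≤_) (trans (sym (+-suc a b)) eq) (s≤s (m≤m+n a b)))) (≤-reflexive 1+[N-1]≡N)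
      1+a∈A : A (suc a) ≡ true
      1+a∈A = trans (proj₂ (invariant (suc a) 1+a<N) m∤1+a) a∈A

  module Quotient {N'} (N≡N'm : N ≡ N' * m) where

    A′ B′ : ℕ → Bool
    A′ y = A (y * m)
    B′ y = B (y * m)

    DirectSum-quotient : DirectSum N' B′ A′
    DirectSum-quotient = record
      { sum< = λ {b} {a} → sum<′ {b} {a} ; cover = cover′ ; unique = λ {b} {a} {b'} {a'} → unique′ {b} {a} {b'} {a'} }
      where
      sum<′ : ∀ {b a} → B′ b ≡ true → A′ a ≡ true → b + a < N'
      sum<′ {b} {a} b∈ a∈ = subst (_< N') (+-comm a b) (*-cancelʳ-< m (a + b) N'
        (subst₂ _<_ (sym (*-distribʳ-+ m a b)) N≡N'm (sum< {a * m} {b * m} a∈ b∈)))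
      cover′ : ∀ {y} → y < N' → ∃₂ λ b a → B′ b ≡ true × A′ a ≡ true × b + a ≡ y
      cover′ {y} y<N' with cover (subst (y * m <_) (sym N≡N'm) (*-monoˡ-< m y<N'))
      ... | a , b , a∈ , b∈ , eq with B⊆mℕ b∈
      ... | divides j refl with ∣m+n∣m⇒∣n (subst (m ∣_) (trans (sym eq) (+-comm a (j * m))) (n∣m*n y)) (n∣m*n j)
      ... | divides i refl = j , i , b∈ , a∈ , trans (+-comm j i) (*-cancelʳ-≡ (i + j) y m (trans (*-distribʳ-+ m i j) eq))
      unique′ : ∀ {b a b' a'} → B′ b ≡ true → A′ a ≡ true → B′ b' ≡ true → A′ a' ≡ true → b + a ≡ b' + a' → b ≡ b'
      unique′ {b} {a} {b'} {a'} b∈ a∈ b'∈ a'∈ eq = *-cancelʳ-≡ b b' m (uniqueʳ a∈ b∈ a'∈ b'∈ (begin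
        a * m + b * m     ≡⟨ *-distribʳ-+ m a b ⟨
        (a + b) * m       ≡⟨ cong (_* m) (trans (+-comm a b) (trans eq (+-comm b' a'))) ⟩
        (a' + b') * m     ≡⟨ *-distribʳ-+ m a' b' ⟩
        a' * m + b' * m   ∎))
        where open ≡-Reasoning

    A≗blocks : ∀ x → A x ≡ blocks m A′ x
    A≗blocks x = Bool-ext (λ x∈A → trans (sym (A-blocks (A-bounded 1≤N x∈A))) x∈A)
                          (λ x∈A′ → trans (A-blocks (x<N x∈A′)) x∈A′)
      where
      x<N : A (x / m * m) ≡ true → x < N
      x<N ⌊x⌋∈A = subst (x <_) (sym N≡N'm)
        (m/o<n⇒m<n*o (*-cancelʳ-< m (x / m) N' (subst (x / m * m <_) N≡N'm (A-bounded 1≤N ⌊x⌋∈A))))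

    B≗dilate : ∀ x → B x ≡ dilate m B′ x
    B≗dilate x with m ∣? x | B x in x∈B?
    ... | yes m∣x | _     = trans (sym x∈B?) (cong B (sym (m/n*n≡m m∣x)))
    ... | no  m∤x | true  = contradiction (B⊆mℕ x∈B?) m∤x
    ... | no  m∤x | false = refl

module _ {N A B} (ds : DirectSum N A B) where

  open DirectSum ds

  least-gap∈B : ∀ {m} → m < N → A m ≡ false → (∀ x → x < m → A x ≡ true) → B m ≡ true
  least-gap∈B {m} m<N gap below with cover m<N
  ... | a , zero , a∈A , _ , eq =
    contradiction (trans (sym a∈A) (trans (cong A (trans (sym (+-identityʳ a)) eq)) gap)) λ ()
  ... | a , suc c , a∈A , c∈B , eq with <-cmp (suc c) m
  ...   | tri≈ _ c≡m _ = subst (λ z → B z ≡ true) c≡m c∈B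
  ...   | tri< c<m _ _ = contradiction
          (unique (below (suc c) c<m) (0∈B 1≤N) (0∈A 1≤N) c∈B (+-identityʳ (suc c))) λ ()
    where
    1≤N : 1 ≤ N
    1≤N = ≤-trans (s≤s z≤n) m<N
  ...   | tri> _ _ c>m = contradiction (subst (suc c ≤_) eq (m≤n+m (suc c) a)) (<⇒≱ c>m)

FromFactorisation : ℕ → (ℕ → Bool) → (ℕ → Bool) → Set
FromFactorisation N A B = ∃ λ ms → All (2 ≤_) ms × product ms ≡ N ×
                                   (∀ x → A x ≡ encodeA ms x) × (∀ x → B x ≡ encodeB ms x)

FromFactorisation-∷ : ∀ {m N' A B A′ B′} .{{_ : NonZero m}} → 2 ≤ m → FromFactorisation N' B′ A′ →
  (∀ x → A x ≡ blocks m A′ x) → (∀ x → B x ≡ dilate m B′ x) → FromFactorisation (m * N') A B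
FromFactorisation-∷ {suc (suc k)} m≥2@(s≤s (s≤s _)) (ms , ms≥2 , ∏ms≡N' , B′≗ , A′≗) A≗ B≗ =
    suc (suc k) ∷ ms , m≥2 ∷ ms≥2 , cong ((2 + k) *_) ∏ms≡N'
  , (λ x → trans (A≗ x) (A′≗ (x / (2 + k))))
  , (λ x → trans (B≗ x) (cong (does (2 + k ∣? x) ∧_) (B′≗ (x / (2 + k)))))

FromFactorisation-[] : FromFactorisation 1 isZero isZero
FromFactorisation-[] = [] , [] , refl , (λ _ → refl) , (λ _ → refl)

FromFactorisation-full : ∀ {N A B} → DirectSum N A B → 2 ≤ N → (∀ x → x < N → A x ≡ true) → FromFactorisation N A B
FromFactorisation-full {N@(suc (suc _))} {A} {B} ds N≥2@(s≤s (s≤s _)) A-full =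
  subst (λ n → FromFactorisation n A B) (*-identityʳ N) (FromFactorisation-∷ N≥2 FromFactorisation-[] A≗ B≗)
  where
  open DirectSum ds
  1≤N : 1 ≤ N
  1≤N = s≤s z≤n
  B⊆0 : ∀ {b} → B b ≡ true → b ≡ 0
  B⊆0 {zero}  _   = refl
  B⊆0 {suc b} b∈B = unique (A-full (suc b) (B-bounded 1≤N b∈B)) (0∈B 1≤N) (0∈A 1≤N) b∈B (+-identityʳ (suc b))
  A≗ : ∀ x → A x ≡ blocks N isZero x
  A≗ x = Bool-ext (λ x∈A → cong isZero (m<n⇒m/n≡0 (A-bounded 1≤N x∈A)))
                  (λ x/N≡0 → A-full x (m/n≡0⇒m<n (isZero⇒≡0 x/N≡0)))
  B≗ : ∀ x → B x ≡ dilate N isZero x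
  B≗ x = Bool-ext (λ x∈B → subst (λ z → dilate N isZero z ≡ true) (sym (B⊆0 x∈B)) (dilate-* N isZero 0))
                  (λ x∈ → let β , x≡βN , β≡0 = dilate⁻ N isZero x∈ in
                          subst (λ z → B z ≡ true) (sym (trans x≡βN (cong (_* N) (isZero⇒≡0 β≡0)))) (0∈B 1≤N))

DirectSum⇒FromFactorisation : ∀ N {A B} → DirectSum N A B → 1 ≤ N → A 1 ≡ true → FromFactorisation N A B
DirectSum⇒FromFactorisation = <-rec _ go
  where
  go : ∀ N → (∀ {N'} → N' < N → ∀ {A B} → DirectSum N' A B → 1 ≤ N' → A 1 ≡ true → FromFactorisation N' A B) →
       ∀ {A B} → DirectSum N A B → 1 ≤ N → A 1 ≡ true → FromFactorisation N A B
  go N rec {A} {B} ds 1≤N 1∈A with least-false A N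
  ... | inj₁ A-full = FromFactorisation-full ds (DirectSum.A-bounded ds 1≤N 1∈A) A-full
  ... | inj₂ (zero , _ , gap , _) = contradiction (trans (sym (DirectSum.0∈A ds 1≤N)) gap) λ ()
  ... | inj₂ (1 , _ , gap , _)    = contradiction (trans (sym 1∈A) gap) λ ()
  ... | inj₂ (m@(suc (suc _)) , m<N , gap , below) with FirstGap.m∣N ds m below (least-gap∈B ds m<N gap below)
  ...   | divides N' N≡N'm = subst (λ n → FromFactorisation n A B) (trans (*-comm m N') (sym N≡N'm))
          (FromFactorisation-∷ (s≤s (s≤s z≤n)) (rec N'<N DirectSum-quotient 1≤N' 1∈B′) A≗blocks B≗dilate)
    where
    m∈B : B m ≡ true
    m∈B = least-gap∈B ds m<N gap below
    open FirstGap.Quotient ds m below m∈B {N'} N≡N'm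
    1∈B′ : B′ 1 ≡ true
    1∈B′ = subst (λ z → B z ≡ true) (sym (*-identityˡ m)) m∈B
    1≤N' : 1 ≤ N'
    1≤N' = *-cancelʳ-< m 0 N' (subst (0 <_) N≡N'm 1≤N)
    N'<N : N' < N
    N'<N = subst (N' <_) (sym N≡N'm) (m<m*n N' m {{>-nonZero 1≤N'}} (s≤s (s≤s z≤n)))

-- Subsets of Fin N as predicates on ℕ

indicator : ∀ {n} → Subset n → ℕ → Bool
indicator []      _       = false
indicator (b ∷ v) zero    = b
indicator (b ∷ v) (suc x) = indicator v x

fromIndicator : ∀ n → (ℕ → Bool) → Subset n
fromIndicator zero    p = []
fromIndicator (suc n) p = p 0 ∷ fromIndicator n (p ∘ suc)

indicator-toℕ : ∀ {n} (v : Subset n) i → indicator v (toℕ i) ≡ lookup v i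
indicator-toℕ (b ∷ v) zero    = refl
indicator-toℕ (b ∷ v) (suc i) = indicator-toℕ v i

indicator⇒< : ∀ {n} (v : Subset n) {x} → indicator v x ≡ true → x < n
indicator⇒< (b ∷ v) {zero}  _ = s≤s z≤n
indicator⇒< (b ∷ v) {suc x} x∈v = s≤s (indicator⇒< v x∈v)

indicator-fromIndicator : ∀ n p → (∀ {x} → p x ≡ true → x < n) → ∀ x → indicator (fromIndicator n p) x ≡ p x
indicator-fromIndicator n p p⊆n x = Bool-ext
  (λ x∈ → trans (sym (indicator-fromIndicator-< n p (indicator⇒< (fromIndicator n p) x∈))) x∈)
  (λ px → trans (indicator-fromIndicator-< n p (p⊆n px)) px)
  where
  indicator-fromIndicator-< : ∀ n p {x} → x < n → indicator (fromIndicator n p) x ≡ p x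
  indicator-fromIndicator-< (suc n) p {zero}  _         = refl
  indicator-fromIndicator-< (suc n) p {suc x} (s≤s x<n) = indicator-fromIndicator-< n (p ∘ suc) x<n

indicator-≗⇒≡ : ∀ {n} (v : Subset n) {p} → (∀ x → indicator v x ≡ p x) → v ≡ fromIndicator n p
indicator-≗⇒≡ []      _   = refl
indicator-≗⇒≡ (b ∷ v) v≗p = cong₂ _∷_ (v≗p 0) (indicator-≗⇒≡ v (v≗p ∘ suc))

members : ∀ {n} → Subset n → List ℕ
members []          = []
members (true  ∷ v) = 0 ∷ map suc (members v)
members (false ∷ v) = map suc (members v)

length-members : ∀ {n} (v : Subset n) → length (members v) ≡ ∣ v ∣
length-members []          = refl
length-members (true  ∷ v) = cong suc (trans (length-map suc (members v)) (length-members v))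
length-members (false ∷ v) = trans (length-map suc (members v)) (length-members v)

∈-members⁺ : ∀ {n} (v : Subset n) {x} → indicator v x ≡ true → x ∈ members v
∈-members⁺ (true  ∷ v) {zero}  _   = here refl
∈-members⁺ (true  ∷ v) {suc x} x∈v = there (∈-map⁺ suc (∈-members⁺ v x∈v))
∈-members⁺ (false ∷ v) {suc x} x∈v = ∈-map⁺ suc (∈-members⁺ v x∈v)

∈-members⁻ : ∀ {n} (v : Subset n) {x} → x ∈ members v → indicator v x ≡ true
∈-members⁻ (true  ∷ v) (here refl) = refl
∈-members⁻ (true  ∷ v) (there x∈)  with y , y∈ , refl ← ∈-map⁻ suc x∈ = ∈-members⁻ v y∈
∈-members⁻ (false ∷ v) x∈          with y , y∈ , refl ← ∈-map⁻ suc x∈ = ∈-members⁻ v y∈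

Unique-members : ∀ {n} (v : Subset n) → Unique (members v)
Unique-members []          = []
Unique-members (true  ∷ v) = All.tabulate 0∉ ∷ Unique.map⁺ suc-injective (Unique-members v)
  where
  0∉ : ∀ {y} → y ∈ map suc (members v) → 0 ≢ y
  0∉ y∈ refl with _ , _ , () ← ∈-map⁻ suc y∈
Unique-members (false ∷ v) = Unique.map⁺ suc-injective (Unique-members v)

2≤∣∣ : ∀ {n} (v : Subset n) {x y} → x ≢ y → indicator v x ≡ true → indicator v y ≡ true → 2 ≤ ∣ v ∣
2≤∣∣ v {x} {y} x≢y x∈v y∈v = subst (2 ≤_) (length-members v) (Unique⇒length≤ ((x≢y ∷ []) ∷ [] ∷ []) xy⊆)
  where
  xy⊆ : x ∷ y ∷ [] ⊆ members v
  xy⊆ (here refl)         = ∈-members⁺ v x∈v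
  xy⊆ (there (here refl)) = ∈-members⁺ v y∈v

∣∣≤1 : ∀ {n} (v : Subset n) → (∀ {x} → indicator v x ≡ true → x ≡ 0) → ∣ v ∣ ≤ 1
∣∣≤1 v v⊆0 = subst (_≤ 1) (length-members v)
  (Unique⇒length≤ {ys = 0 ∷ []} (Unique-members v) (λ x∈ → here (v⊆0 (∈-members⁻ v x∈))))

∈ₛ⇒indicator : ∀ {n} (v : Subset n) {i} → i ∈ₛ v → indicator v (toℕ i) ≡ true
∈ₛ⇒indicator v {i} i∈v = trans (indicator-toℕ v i) ([]=⇒lookup i∈v)

indicator⇒∈ₛ : ∀ {n} (v : Subset n) {x} (x<n : x < n) → indicator v x ≡ true → fromℕ< x<n ∈ₛ v
indicator⇒∈ₛ v x<n x∈v =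
  lookup⇒[]= (fromℕ< x<n) v (trans (sym (indicator-toℕ v (fromℕ< x<n))) (trans (cong (indicator v) (toℕ-fromℕ< x<n)) x∈v))

module _ {N} (A₁ A₂ : Subset N) where

  private
    pairs : List (ℕ × ℕ)
    pairs = cartesianProduct (members A₁) (members A₂)

    length-pairs : length pairs ≡ ∣ A₁ ∣ * ∣ A₂ ∣
    length-pairs = trans (length-cartesianProduct (members A₁) (members A₂)) (cong₂ _*_ (length-members A₁) (length-members A₂))

    ∈-pairs⁺ : ∀ {a b} → indicator A₁ a ≡ true → indicator A₂ b ≡ true → (a , b) ∈ pairs
    ∈-pairs⁺ a∈ b∈ = ∈-cartesianProduct⁺ (∈-members⁺ A₁ a∈) (∈-members⁺ A₂ b∈)

    ∈-pairs⁻ : ∀ {a b} → (a , b) ∈ pairs → indicator A₁ a ≡ true × indicator A₂ b ≡ true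
    ∈-pairs⁻ ab∈ with a∈ , b∈ ← ∈-cartesianProduct⁻ (members A₁) (members A₂) ab∈ = ∈-members⁻ A₁ a∈ , ∈-members⁻ A₂ b∈

  -- The size condition |A₁| |A₂| = N turns "A₁ + A₂ = [0, N)" into uniqueness of representations.
  IsSumSystem⇒DirectSum : IsSumSystem N A₁ A₂ → DirectSum N (indicator A₁) (indicator A₂)
  IsSumSystem⇒DirectSum (_ , _ , |A₁||A₂|≡N , sum<N , covers) = record { sum< = sum<′ ; cover = cover′ ; unique = unique′ }
    where
    sum<′ : ∀ {a b} → indicator A₁ a ≡ true → indicator A₂ b ≡ true → a + b < N
    sum<′ {a} {b} a∈ b∈ = subst₂ (λ a b → a + b < N) (toℕ-fromℕ< a<N) (toℕ-fromℕ< b<N)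
      (sum<N _ _ (indicator⇒∈ₛ A₁ a<N a∈) (indicator⇒∈ₛ A₂ b<N b∈))
      where
      a<N : a < N
      a<N = indicator⇒< A₁ a∈
      b<N : b < N
      b<N = indicator⇒< A₂ b∈
    cover′ : ∀ {x} → x < N → ∃₂ λ a b → indicator A₁ a ≡ true × indicator A₂ b ≡ true × a + b ≡ x
    cover′ x<N with i , j , i∈ , j∈ , eq ← covers (fromℕ< x<N) =
      toℕ i , toℕ j , ∈ₛ⇒indicator A₁ i∈ , ∈ₛ⇒indicator A₂ j∈ , trans eq (toℕ-fromℕ< x<N)
    upTo⊆sums : upTo N ⊆ map (uncurry _+_) pairs
    upTo⊆sums x∈ with a , b , a∈ , b∈ , refl ← cover′ (∈-upTo⁻ x∈) = ∈-map⁺ (uncurry _+_) (∈-pairs⁺ a∈ b∈)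
    unique′ : ∀ {a b a' b'} → indicator A₁ a ≡ true → indicator A₂ b ≡ true → indicator A₁ a' ≡ true → indicator A₂ b' ≡ true →
              a + b ≡ a' + b' → a ≡ a'
    unique′ a∈ b∈ a'∈ b'∈ eq = cong proj₁
      (length≤⇒injectiveOn (uncurry _+_) (≡-dec _≟_ _≟_) (Unique.upTo⁺ N) upTo⊆sums
        (≤-reflexive (trans length-pairs (trans |A₁||A₂|≡N (sym (length-upTo N)))))
        (∈-pairs⁺ a∈ b∈) (∈-pairs⁺ a'∈ b'∈) eq)

  DirectSum⇒IsSumSystem : DirectSum N (indicator A₁) (indicator A₂) → 2 ≤ ∣ A₁ ∣ → 2 ≤ ∣ A₂ ∣ → IsSumSystem N A₁ A₂
  DirectSum⇒IsSumSystem ds 2≤∣A₁∣ 2≤∣A₂∣ = 2≤∣A₁∣ , 2≤∣A₂∣ , |A₁||A₂|≡N , sum<N , covers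
    where
    open DirectSum ds
    +-injectiveOn : ∀ {p q} → p ∈ pairs → q ∈ pairs → uncurry _+_ p ≡ uncurry _+_ q → p ≡ q
    +-injectiveOn p∈ q∈ eq with a∈ , b∈ ← ∈-pairs⁻ p∈ | a'∈ , b'∈ ← ∈-pairs⁻ q∈ =
      cong₂ _,_ (unique a∈ b∈ a'∈ b'∈ eq) (uniqueʳ a∈ b∈ a'∈ b'∈ eq)
    sums⊆upTo : map (uncurry _+_) pairs ⊆ upTo N
    sums⊆upTo x∈ with _ , p∈ , refl ← ∈-map⁻ (uncurry _+_) x∈ with a∈ , b∈ ← ∈-pairs⁻ p∈ = ∈-upTo⁺ (sum< a∈ b∈)
    upTo⊆sums : upTo N ⊆ map (uncurry _+_) pairs
    upTo⊆sums x∈ with a , b , a∈ , b∈ , refl ← cover (∈-upTo⁻ x∈) = ∈-map⁺ (uncurry _+_) (∈-pairs⁺ a∈ b∈)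
    |A₁||A₂|≡N : ∣ A₁ ∣ * ∣ A₂ ∣ ≡ N
    |A₁||A₂|≡N = begin
      ∣ A₁ ∣ * ∣ A₂ ∣                      ≡⟨ length-pairs ⟨
      length pairs                         ≡⟨ length-map (uncurry _+_) pairs ⟨
      length (map (uncurry _+_) pairs)     ≡⟨ Unique⇒length≡ (map⁺-injectiveOn (uncurry _+_)
                                                (Unique.cartesianProduct⁺ (Unique-members A₁) (Unique-members A₂)) +-injectiveOn)
                                                (Unique.upTo⁺ N) sums⊆upTo upTo⊆sums ⟩
      length (upTo N)                      ≡⟨ length-upTo N ⟩
      N                                    ∎
      where open ≡-Reasoning
    sum<N : ∀ (a b : Fin N) → a ∈ₛ A₁ → b ∈ₛ A₂ → toℕ a + toℕ b < N
    sum<N a b a∈ b∈ = sum< (∈ₛ⇒indicator A₁ a∈) (∈ₛ⇒indicator A₂ b∈)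
    covers : ∀ (k : Fin N) → Σ (Fin N) λ a → Σ (Fin N) λ b → a ∈ₛ A₁ × b ∈ₛ A₂ × toℕ a + toℕ b ≡ toℕ k
    covers k with a , b , a∈ , b∈ , eq ← cover (toℕ<n k) =
        fromℕ< a<N , fromℕ< b<N , indicator⇒∈ₛ A₁ a<N a∈ , indicator⇒∈ₛ A₂ b<N b∈
      , trans (cong₂ _+_ (toℕ-fromℕ< a<N) (toℕ-fromℕ< b<N)) eq
      where
      a<N : a < N
      a<N = indicator⇒< A₁ a∈
      b<N : b < N
      b<N = indicator⇒< A₂ b∈

Unique-allSubsets : ∀ n → Unique (allSubsets n)
Unique-allSubsets zero    = [] ∷ []
Unique-allSubsets (suc n) =
  Unique.++⁺ (Unique.map⁺ ∷-injectiveʳᵥ (Unique-allSubsets n)) (Unique.map⁺ ∷-injectiveʳᵥ (Unique-allSubsets n))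
    λ (v∈ᵢ , v∈ₒ) → inside≢outside v∈ᵢ v∈ₒ
  where
  inside≢outside : ∀ {v} → v ∈ map (inside ∷_) (allSubsets n) → v ∈ map (outside ∷_) (allSubsets n) → ⊥
  inside≢outside v∈ᵢ v∈ₒ with _ , _ , refl ← ∈-map⁻ _ v∈ᵢ | _ , _ , () ← ∈-map⁻ _ v∈ₒ

∈-allSubsets : ∀ {n} (v : Subset n) → v ∈ allSubsets n
∈-allSubsets []                = here refl
∈-allSubsets {suc n} (true  ∷ v) = ∈-++⁺ˡ (∈-map⁺ _ (∈-allSubsets v))
∈-allSubsets {suc n} (false ∷ v) = ∈-++⁺ʳ (map (inside ∷_) (allSubsets n)) (∈-map⁺ _ (∈-allSubsets v))

-- Counting sum systems

module SumSystems (N : ℕ) where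

  encodeAₛ encodeBₛ : List ℕ → Subset N
  encodeAₛ ms = fromIndicator N (encodeA ms)
  encodeBₛ ms = fromIndicator N (encodeB ms)

  -- the flag records whether 1 lies in the first part
  sumSystemOf : List ℕ × Bool → Subset N × Subset N
  sumSystemOf (ms , true)  = encodeAₛ ms , encodeBₛ ms
  sumSystemOf (ms , false) = encodeBₛ ms , encodeAₛ ms

  flags : List Bool
  flags = true ∷ false ∷ []

  module _ {ms} (ms≥2 : All (2 ≤_) ms) (∏ms≡N : product ms ≡ N) where

    DirectSum-encodeN : DirectSum N (encodeA ms) (encodeB ms)
    DirectSum-encodeN = subst (λ n → DirectSum n (encodeA ms) (encodeB ms)) ∏ms≡N (DirectSum-encode ms≥2)

    private
      1≤N : 1 ≤ N
      1≤N = subst (1 ≤_) ∏ms≡N (product≥1 ms≥2)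

    indicator-encodeAₛ : ∀ x → indicator (encodeAₛ ms) x ≡ encodeA ms x
    indicator-encodeAₛ = indicator-fromIndicator N (encodeA ms) (DirectSum.A-bounded DirectSum-encodeN 1≤N)

    indicator-encodeBₛ : ∀ x → indicator (encodeBₛ ms) x ≡ encodeB ms x
    indicator-encodeBₛ = indicator-fromIndicator N (encodeB ms) (DirectSum.B-bounded DirectSum-encodeN 1≤N)

    DirectSum-encodeₛ : DirectSum N (indicator (encodeAₛ ms)) (indicator (encodeBₛ ms))
    DirectSum-encodeₛ = DirectSum-resp (sym ∘ indicator-encodeAₛ) (sym ∘ indicator-encodeBₛ) DirectSum-encodeN

  encodeB-first : ∀ {m ms} → All (2 ≤_) (m ∷ ms) → encodeB (m ∷ ms) m ≡ encodeA ms 1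
  encodeB-first {suc (suc k)} {ms} (s≤s (s≤s _) ∷ _) =
    trans (cong (encodeB (2 + k ∷ ms)) (sym (*-identityˡ (2 + k)))) (dilate-* (2 + k) (encodeA ms) 1)

  encode-sizes : ∀ {m m' ms} → All (2 ≤_) (m ∷ m' ∷ ms) → product (m ∷ m' ∷ ms) ≡ N →
                 2 ≤ ∣ encodeAₛ (m ∷ m' ∷ ms) ∣ × 2 ≤ ∣ encodeBₛ (m ∷ m' ∷ ms) ∣
  encode-sizes {m} {m'} {ms} ms≥2@(m≥2 ∷ ms'≥2@(m'≥2 ∷ _)) ∏ms≡N =
      2≤∣∣ (encodeAₛ (m ∷ m' ∷ ms)) (λ ())
        (trans (indicator-encodeAₛ ms≥2 ∏ms≡N 0) (proj₁ (encode-0 ms≥2)))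
        (trans (indicator-encodeAₛ ms≥2 ∏ms≡N 1) (encodeA-below ms≥2 1 m≥2))
    , 2≤∣∣ (encodeBₛ (m ∷ m' ∷ ms)) {0} {m} (<⇒≢ (≤-trans (s≤s z≤n) m≥2))
        (trans (indicator-encodeBₛ ms≥2 ∏ms≡N 0) (proj₂ (encode-0 ms≥2)))
        (trans (indicator-encodeBₛ ms≥2 ∏ms≡N m) (trans (encodeB-first ms≥2) (encodeA-below ms'≥2 1 m'≥2)))

  sumSystemOf-valid : ∀ {ms k} flag → Factorisation (2 + k) N ms →
                      IsSumSystem N (proj₁ (sumSystemOf (ms , flag))) (proj₂ (sumSystemOf (ms , flag)))
  sumSystemOf-valid {_ ∷ _ ∷ _} true  (_ , ms≥2 , ∏ms≡N) with 2≤∣A∣ , 2≤∣B∣ ← encode-sizes ms≥2 ∏ms≡N =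
    DirectSum⇒IsSumSystem _ _ (DirectSum-encodeₛ ms≥2 ∏ms≡N) 2≤∣A∣ 2≤∣B∣
  sumSystemOf-valid {_ ∷ _ ∷ _} false (_ , ms≥2 , ∏ms≡N) with 2≤∣A∣ , 2≤∣B∣ ← encode-sizes ms≥2 ∏ms≡N =
    DirectSum⇒IsSumSystem _ _ (DirectSum-swap (DirectSum-encodeₛ ms≥2 ∏ms≡N)) 2≤∣B∣ 2≤∣A∣

  first-contains-1 : ∀ {m ms} flag → All (2 ≤_) (m ∷ ms) → product (m ∷ ms) ≡ N →
                     indicator (proj₁ (sumSystemOf (m ∷ ms , flag))) 1 ≡ flag
  first-contains-1 true  ms≥2@(m≥2 ∷ _) ∏ms≡N = trans (indicator-encodeAₛ ms≥2 ∏ms≡N 1) (encodeA-below ms≥2 1 m≥2)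
  first-contains-1 false ms≥2           ∏ms≡N = trans (indicator-encodeBₛ ms≥2 ∏ms≡N 1) (encodeB-1 ms≥2)

  encodings≡ : ∀ flag {ms ms'} → sumSystemOf (ms , flag) ≡ sumSystemOf (ms' , flag) →
               encodeAₛ ms ≡ encodeAₛ ms' × encodeBₛ ms ≡ encodeBₛ ms'
  encodings≡ true  eq = cong proj₁ eq , cong proj₂ eq
  encodings≡ false eq = cong proj₂ eq , cong proj₁ eq

  sumSystemOf-injective : ∀ {ms ms' k k'} f f' → Factorisation (2 + k) N ms → Factorisation (2 + k') N ms' →
                          sumSystemOf (ms , f) ≡ sumSystemOf (ms' , f') → (ms , f) ≡ (ms' , f')
  sumSystemOf-injective {_ ∷ _} {_ ∷ _} f f' (_ , ms≥2 , ∏ms≡N) (_ , ms'≥2 , ∏ms'≡N) eq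
    with refl ← trans (sym (first-contains-1 f ms≥2 ∏ms≡N))
                  (trans (cong (λ p → indicator (proj₁ p) 1) eq) (first-contains-1 f' ms'≥2 ∏ms'≡N))
    with A≡ , B≡ ← encodings≡ f eq
    = cong (_, f) (encode-injective ms≥2 ms'≥2
        (transport (indicator-encodeAₛ ms≥2 ∏ms≡N) (indicator-encodeAₛ ms'≥2 ∏ms'≡N) A≡)
        (transport (indicator-encodeBₛ ms≥2 ∏ms≡N) (indicator-encodeBₛ ms'≥2 ∏ms'≡N) B≡))
    where
    transport : ∀ {P P' : ℕ → Bool} {v v' : Subset N} → (∀ x → indicator v x ≡ P x) → (∀ x → indicator v' x ≡ P' x) →
                v ≡ v' → ∀ x → P x ≡ P' x
    transport v≗P v'≗P' refl x = trans (sym (v≗P x)) (v'≗P' x)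

  FromFactorisation⇒≡encodeₛ : ∀ {P Q : Subset N} → 2 ≤ ∣ P ∣ → 2 ≤ ∣ Q ∣ → FromFactorisation N (indicator P) (indicator Q) →
    ∃₂ λ ms k → Factorisation (2 + k) N ms × P ≡ encodeAₛ ms × Q ≡ encodeBₛ ms
  FromFactorisation⇒≡encodeₛ {P} {Q} 2≤∣P∣ _ ([] , _ , _ , P≗ , _) =
    contradiction 2≤∣P∣ (<⇒≱ (s≤s (∣∣≤1 P λ {x} x∈P → isZero⇒≡0 (trans (sym (P≗ x)) x∈P))))
  FromFactorisation⇒≡encodeₛ {P} {Q} _ 2≤∣Q∣ (m ∷ [] , s≤s _ ∷ [] , _ , _ , Q≗) =
    contradiction 2≤∣Q∣ (<⇒≱ (s≤s (∣∣≤1 Q λ {x} x∈Q → singleton⊆0 (trans (sym (Q≗ x)) x∈Q))))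
    where
    singleton⊆0 : ∀ {x} → encodeB (m ∷ []) x ≡ true → x ≡ 0
    singleton⊆0 {x} x∈ with β , refl , β≡0 ← dilate⁻ m isZero {x} x∈ = cong (_* m) (isZero⇒≡0 β≡0)
  FromFactorisation⇒≡encodeₛ {P} {Q} _ _ (ms@(_ ∷ _ ∷ ms') , ms≥2 , ∏ms≡N , P≗ , Q≗) =
    ms , length ms' , (refl , ms≥2 , ∏ms≡N) , indicator-≗⇒≡ P P≗ , indicator-≗⇒≡ Q Q≗

  sumSystemOf-surjective : ∀ {A₁ A₂} → IsSumSystem N A₁ A₂ →
    ∃₂ λ ms flag → (∃ λ k → Factorisation (2 + k) N ms) × sumSystemOf (ms , flag) ≡ (A₁ , A₂)
  sumSystemOf-surjective {A₁} {A₂} sys@(2≤∣A₁∣ , 2≤∣A₂∣ , |A₁||A₂|≡N , _) = by-side-of-1 (DirectSum.cover ds 1<N)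
    where
    ds : DirectSum N (indicator A₁) (indicator A₂)
    ds = IsSumSystem⇒DirectSum A₁ A₂ sys
    1<N : 1 < N
    1<N = subst (1 <_) |A₁||A₂|≡N (≤-trans (s≤s (s≤s z≤n)) (*-mono-≤ 2≤∣A₁∣ 2≤∣A₂∣))
    1≤N : 1 ≤ N
    1≤N = <⇒≤ 1<N
    by-side-of-1 : (∃₂ λ a b → indicator A₁ a ≡ true × indicator A₂ b ≡ true × a + b ≡ 1) →
                   ∃₂ λ ms flag → (∃ λ k → Factorisation (2 + k) N ms) × sumSystemOf (ms , flag) ≡ (A₁ , A₂)
    by-side-of-1 (1 , 0 , 1∈A₁ , _ , _)
      with ms , k , fact , A₁≡ , A₂≡ ← FromFactorisation⇒≡encodeₛ {A₁} {A₂} 2≤∣A₁∣ 2≤∣A₂∣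
                                          (DirectSum⇒FromFactorisation N ds 1≤N 1∈A₁)
      = ms , true , (k , fact) , sym (cong₂ _,_ A₁≡ A₂≡)
    by-side-of-1 (0 , 1 , _ , 1∈A₂ , _)
      with ms , k , fact , A₂≡ , A₁≡ ← FromFactorisation⇒≡encodeₛ {A₂} {A₁} 2≤∣A₂∣ 2≤∣A₁∣
                                          (DirectSum⇒FromFactorisation N (DirectSum-swap ds) 1≤N 1∈A₂)
      = ms , false , (k , fact) , sym (cong₂ _,_ A₁≡ A₂≡)

  candidates : ℕ → List (List ℕ × Bool)
  candidates M = cartesianProduct (factorisations≥2 M N) flags

  ∈-flags : ∀ flag → flag ∈ flags
  ∈-flags true  = here refl
  ∈-flags false = there (here refl)

  ∈-candidates⁻ : ∀ {M ms flag} → (ms , flag) ∈ candidates M → ∃ λ k → Factorisation (2 + k) N ms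
  ∈-candidates⁻ {M} p∈ = factorisations≥2⁻ M N (proj₁ (∈-cartesianProduct⁻ (factorisations≥2 M N) flags p∈))

  𝒩₂≡length-image : ∀ M → N ≤ M → 𝒩₂ N ≡ length (map sumSystemOf (candidates M))
  𝒩₂≡length-image M N≤M = Unique⇒length≡
    (Unique.filter⁺ isSumSystem?′ (Unique.cartesianProduct⁺ (Unique-allSubsets N) (Unique-allSubsets N)))
    (map⁺-injectiveOn sumSystemOf (Unique.cartesianProduct⁺ (Unique-factorisations≥2 M N) (((λ ()) ∷ []) ∷ [] ∷ [])) injective)
    sumSystems⊆image image⊆sumSystems
    where
    allPairs : List (Subset N × Subset N)
    allPairs = cartesianProduct (allSubsets N) (allSubsets N)
    isSumSystem?′ : ∀ (p : Subset N × Subset N) → Dec (IsSumSystem N (proj₁ p) (proj₂ p))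
    isSumSystem?′ p = isSumSystem? N (proj₁ p) (proj₂ p)
    injective : ∀ {p q} → p ∈ candidates M → q ∈ candidates M → sumSystemOf p ≡ sumSystemOf q → p ≡ q
    injective {_ , f} {_ , f'} p∈ q∈ = sumSystemOf-injective f f' (proj₂ (∈-candidates⁻ {M} p∈)) (proj₂ (∈-candidates⁻ {M} q∈))
    sumSystems⊆image : filter isSumSystem?′ allPairs ⊆ map sumSystemOf (candidates M)
    sumSystems⊆image p∈ with ms , flag , (k , fact@(|ms|≡2+k , ms≥2 , ∏ms≡N)) , refl
                             ← sumSystemOf-surjective (proj₂ (∈-filter⁻ isSumSystem?′ {xs = allPairs} p∈)) =
      ∈-map⁺ sumSystemOf (∈-cartesianProduct⁺ (factorisations≥2⁺ M N k≤M fact) (∈-flags flag))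
      where
      k≤M : k ≤ M
      k≤M = ≤-trans (m≤n+m k 2) (≤-trans (<⇒≤ (subst₂ _<_ |ms|≡2+k ∏ms≡N (length<product ms≥2))) N≤M)
    image⊆sumSystems : map sumSystemOf (candidates M) ⊆ filter isSumSystem?′ allPairs
    image⊆sumSystems p∈ with (ms , flag) , q∈ , refl ← ∈-map⁻ sumSystemOf p∈ =
      ∈-filter⁺ isSumSystem?′ (∈-cartesianProduct⁺ (∈-allSubsets _) (∈-allSubsets _))
        (sumSystemOf-valid flag (proj₂ (∈-candidates⁻ {M} q∈)))

corollary3p3 : (N : ℕ) → 1 ≤ N →
    ∃ λ M₀ → (M : ℕ) → M₀ ≤ M → 𝒩₂ N ≡ 2 * sumTo (λ k → c (2 + k) N) M
corollary3p3 N _ = N , λ M N≤M → begin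
  𝒩₂ N                                        ≡⟨ 𝒩₂≡length-image M N≤M ⟩
  length (map sumSystemOf (candidates M))     ≡⟨ length-map sumSystemOf (candidates M) ⟩
  length (candidates M)                       ≡⟨ length-cartesianProduct (factorisations≥2 M N) flags ⟩
  length (factorisations≥2 M N) * 2           ≡⟨ *-comm (length (factorisations≥2 M N)) 2 ⟩
  2 * length (factorisations≥2 M N)           ≡⟨ cong (2 *_) (length-factorisations≥2 M N) ⟩
  2 * sumTo (λ k → c (2 + k) N) M             ∎
  where
  open SumSystems N
  open ≡-Reasoning
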